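{- Let $G$ be a banana tree, and let $k$ be the largest positive integer such that there exists a set $W$ of at least $k$ vertices of $G$ inducing a connected subgraph in which every pair of adjacent vertices is joined by at least $k$ edges. Then $\mathrm{sn}(G)=\mathrm{scw}(G)=k$.
   Context: Graphs are finite, connected, loopless multigraphs. A banana tree is a multigraph whose underlying simple graph (one edge kept between each adjacent pair) is a tree. For $S\subseteq V(G)$, $G[S]$ is the induced subgraph. A scramble on $G$ is a finite collection $\mathcal{S}=\{V_1,\ldots,V_m\}$ of nonempty vertex sets (eggs) with each $G[V_i]$ connected. The hitting number $h(\mathcal{S})$ is the minimum size of a vertex set meeting every egg. An egg-cut is a set $T$ of edges such that $(V(G),E(G)\setminus T)$ has at least two connected components each of which completely contains some egg; the egg-cut number $e(\mathcal{S})$ is the minimum size of an egg-cut (taken to be $\infty$ if none exists). The order of $\mathcal{S}$ is $\min\{h(\mathcal{S}),e(\mathcal{S})\}$, and the scramble number $\mathrm{sn}(G)$ is the maximum order of a scramble on $G$. A tree-cut decomposition of $G$ is a pair $(T,\mathcal{X})$ where $T$ is a tree (whose vertices are called nodes and edges links) and $\mathcal{X}:V(G)\to V(T)$ is any function. Each edge $uv$ of $G$ is routed along the unique path in $T$ from $\mathcal{X}(u)$ to $\mathcal{X}(v)$. The weight of a link is the number of edges of $G$ whose path uses that link; the weight of a node $t$ is $|\mathcal{X}^{ -1}(t)|$ plus the number of edges of $G$ whose path passes through $t$ but neither of whose endpoints is mapped to $t$. The width of the decomposition is the maximum weight of a node or link, and the screewidth $\mathrm{scw}(G)$ is the minimum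 width of a tree-cut decomposition of $G$. -}

module Defs where

open import Data.Nat using (ℕ; zero; suc; _+_; _*_; _∸_; _≤_; _<_)
open import Data.Fin using (Fin; zero; suc)
open import Data.Fin.Properties using (_≟_) renaming (_<?_ to _<ᶠ?_)
open import Data.Bool using (Bool; true; false; if_then_else_; _∧_; _∨_; not)
open import Data.List using (List; []; _∷_; length)
open import Data.List.Relation.Unary.All using (All)
open import Data.List.Relation.Unary.Unique.Propositional using (Unique)
open import Data.List.Membership.Propositional using (_∈_)
open import Data.Product using (Σ; ∃; _×_; _,_)
open import Relation.Nullary using (¬_; does)
open import Relation.Binary.PropositionalEquality using (_≡_)

sumFin : {n : ℕ} → (Fin n → ℕ) → ℕ
sumFin {zero}  f = 0
sumFin {suc n} f = f zero + sumFin (λ i → f (suc i))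

card : {n : ℕ} → (Fin n → Bool) → ℕ
card S = sumFin (λ v → if S v then 1 else 0)

sumPairs : {n : ℕ} → (Fin n → Fin n → ℕ) → ℕ
sumPairs f = sumFin (λ u → sumFin (λ v → if does (u <ᶠ? v) then f u v else 0))

data IsWalk {n : ℕ} (A : Fin n → Fin n → Set) : List (Fin n) → Fin n → Fin n → Set where
  single : (x : Fin n) → IsWalk A (x ∷ []) x x
  step   : {x y z : Fin n} {ys : List (Fin n)} →
           A x y → IsWalk A (y ∷ ys) y z → IsWalk A (x ∷ y ∷ ys) x z

IsPath : {n : ℕ} (A : Fin n → Fin n → Set) → List (Fin n) → Fin n → Fin n → Set
IsPath A xs x y = IsWalk A xs x y × Unique xs

ConnectedAdj : {n : ℕ} → (Fin n → Fin n → Set) → Set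
ConnectedAdj {n} A = (x y : Fin n) → ∃ λ xs → IsWalk A xs x y

HasCycle : {n : ℕ} → (Fin n → Fin n → Set) → Set
HasCycle {n} A = Σ (List (Fin n)) λ xs → Σ (Fin n) λ x → Σ (Fin n) λ y →
  (3 ≤ length xs) × IsPath A xs x y × A y x

IsTreeAdj : {n : ℕ} → (Fin n → Fin n → Set) → Set
IsTreeAdj {n} A = (1 ≤ n) × ConnectedAdj A × ¬ HasCycle A

record Multigraph (n : ℕ) : Set where
  field
    mult     : Fin n → Fin n → ℕ
    sym      : (u v : Fin n) → mult u v ≡ mult v u
    loopless : (v : Fin n) → mult v v ≡ 0
open Multigraph public

Adj : {n : ℕ} → Multigraph n → Fin n → Fin n → Set
Adj G u v = 0 < mult G u v

InducedConnected : {n : ℕ} → Multigraph n → (Fin n → Bool) → Set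
InducedConnected {n} G S =
  (∃ λ v → S v ≡ true) ×
  ((x y : Fin n) → S x ≡ true → S y ≡ true →
     ∃ λ xs → IsWalk (Adj G) xs x y × All (λ z → S z ≡ true) xs)

IsConnectedGraph : {n : ℕ} → Multigraph n → Set
IsConnectedGraph {n} G = (1 ≤ n) × ConnectedAdj (Adj G)

IsBananaTree : {n : ℕ} → Multigraph n → Set
IsBananaTree G = IsTreeAdj (Adj G)

record Scramble {n : ℕ} (G : Multigraph n) : Set where
  field
    eggs      : List (Fin n → Bool)
    eggsConn  : All (InducedConnected G) eggs
open Scramble public

IsHittingSet : {n : ℕ} {G : Multigraph n} → Scramble G → (Fin n → Bool) → Set
IsHittingSet 𝒮 H = All (λ E → ∃ λ v → E v ≡ true × H v ≡ true) (eggs 𝒮)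

HittingAtLeast : {n : ℕ} {G : Multigraph n} → Scramble G → ℕ → Set
HittingAtLeast {n} 𝒮 k = (H : Fin n → Bool) → IsHittingSet 𝒮 H → k ≤ card H

record EdgeSet {n : ℕ} (G : Multigraph n) : Set where
  field
    tm    : Fin n → Fin n → ℕ
    tsym  : (u v : Fin n) → tm u v ≡ tm v u
    tsub  : (u v : Fin n) → tm u v ≤ mult G u v
open EdgeSet public

edgeSetSize : {n : ℕ} {G : Multigraph n} → EdgeSet G → ℕ
edgeSetSize T = sumPairs (tm T)

AdjMinus : {n : ℕ} (G : Multigraph n) → EdgeSet G → Fin n → Fin n → Set
AdjMinus G T u v = 0 < mult G u v ∸ tm T u v

ReachMinus : {n : ℕ} (G : Multigraph n) → EdgeSet G → Fin n → Fin n → Set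
ReachMinus G T x y = ∃ λ xs → IsWalk (AdjMinus G T) xs x y

CompContains : {n : ℕ} (G : Multigraph n) → EdgeSet G → Fin n → (Fin n → Bool) → Set
CompContains {n} G T a E = (x : Fin n) → E x ≡ true → ReachMinus G T a x

IsEggCut : {n : ℕ} {G : Multigraph n} → Scramble G → EdgeSet G → Set
IsEggCut {n} {G} 𝒮 T =
  Σ (Fin n → Bool) λ A → Σ (Fin n → Bool) λ B → Σ (Fin n) λ a → Σ (Fin n) λ b →
    (A ∈ eggs 𝒮) × (B ∈ eggs 𝒮) ×
    CompContains G T a A × CompContains G T b B × ¬ ReachMinus G T a b

-- e(𝒮) ≥ k  (vacuous if there is no egg-cut, i.e. e = ∞)
EggCutAtLeast : {n : ℕ} {G : Multigraph n} → Scramble G → ℕ → Set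
EggCutAtLeast 𝒮 k = (T : EdgeSet _) → IsEggCut 𝒮 T → k ≤ edgeSetSize T

OrderAtLeast : {n : ℕ} {G : Multigraph n} → Scramble G → ℕ → Set
OrderAtLeast 𝒮 k = HittingAtLeast 𝒮 k × EggCutAtLeast 𝒮 k

ScrambleNumberIs : {n : ℕ} → Multigraph n → ℕ → Set
ScrambleNumberIs G k =
  (∃ λ (𝒮 : Scramble G) → OrderAtLeast 𝒮 k) ×
  ((𝒮 : Scramble G) → ¬ OrderAtLeast 𝒮 (suc k))

-- Since paths in a tree are
-- unique, the decomposition carries, for every pair u v joined by an edge,
-- the (necessarily unique) path route u v from 𝒳 u to 𝒳 v in T.
record TreeCutDecomp {n : ℕ} (G : Multigraph n) : Set₁ where
  field
    p        : ℕ
    tadj     : Fin p → Fin p → Set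
    tadjSym  : (a b : Fin p) → tadj a b → tadj b a
    tadjIrr  : (a : Fin p) → ¬ tadj a a
    isTree   : IsTreeAdj tadj
    𝒳        : Fin n → Fin p
    route    : Fin n → Fin n → List (Fin p)
    routeOk  : (u v : Fin n) → 0 < mult G u v → IsPath tadj (route u v) (𝒳 u) (𝒳 v)
open TreeCutDecomp public

usesLink : {p : ℕ} → Fin p → Fin p → List (Fin p) → Bool
usesLink a b []           = false
usesLink a b (x ∷ [])     = false
usesLink a b (x ∷ y ∷ ys) =
  ((does (x ≟ a) ∧ does (y ≟ b)) ∨ (does (x ≟ b) ∧ does (y ≟ a))) ∨ usesLink a b (y ∷ ys)

elemB : {p : ℕ} → Fin p → List (Fin p) → Bool
elemB a []       = false
elemB a (x ∷ xs) = does (x ≟ a) ∨ elemB a xs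

module _ {n : ℕ} {G : Multigraph n} (D : TreeCutDecomp G) where

  linkWeight : Fin (p D) → Fin (p D) → ℕ
  linkWeight a b = sumPairs (λ u v →
    if usesLink a b (route D u v) then mult G u v else 0)

  nodeWeight : Fin (p D) → ℕ
  nodeWeight t =
    card (λ v → does (𝒳 D v ≟ t)) +
    sumPairs (λ u v →
      if elemB t (route D u v) ∧ not (does (𝒳 D u ≟ t)) ∧ not (does (𝒳 D v ≟ t))
      then mult G u v else 0)

  WidthAtMost : ℕ → Set
  WidthAtMost w = ((t : Fin (p D)) → nodeWeight t ≤ w) ×
                  ((a b : Fin (p D)) → tadj D a b → linkWeight a b ≤ w)

ScreewidthIs : {n : ℕ} → Multigraph n → ℕ → Set₁
ScreewidthIs G k =
  (Σ (TreeCutDecomp G) λ D → WidthAtMost D k) ×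
  ((D : TreeCutDecomp G) (w : ℕ) → WidthAtMost D w → k ≤ w)

HasThickSet : {n : ℕ} → Multigraph n → ℕ → Set
HasThickSet {n} G k = Σ (Fin n → Bool) λ W →
  (k ≤ card W) × InducedConnected G W ×
  ((u v : Fin n) → W u ≡ true → W v ≡ true → 0 < mult G u v → k ≤ mult G u v)

IsLargestThick : {n : ℕ} → Multigraph n → ℕ → Set
IsLargestThick G k = (1 ≤ k) × HasThickSet G k × ((j : ℕ) → HasThickSet G j → j ≤ k)

-- Lower bounds: let W witness the thickness k.  The singletons of W form a
-- scramble of order at least k, because a hitting set contains W and an
-- egg-cut between two vertices of W must remove a whole bundle of at least k
-- parallel edges of G[W].  In a tree-cut decomposition either all of W sits in
-- one node, or some edge bundle of G[W] is routed over a link.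
--
-- Upper bounds: root the tree and call the bundle between a vertex and its
-- parent heavy if it has more than k edges.  A heavy class (a component of the
-- heavy bundles) is connected with all bundles of size at least k + 1, so by
-- maximality of k it has at most k vertices.  Contracting every heavy class to
-- a node gives a tree-cut decomposition of width at most k: routes have no
-- interior nodes and every link carries a single light bundle.  Given a
-- scramble of order greater than k, let t be the deepest top of a heavy class
-- whose subtree meets every egg.  The heavy class of t meets every egg:
-- otherwise some egg lies below a deeper top t′, some other egg avoids the
-- subtree of t′, and the light bundle above t′ is an egg-cut of size at most k.
-- So the scramble has a hitting set of size at most k.

module Submission where

open import Defs renaming (sym to mult-sym)
open import Data.Bool using (Bool; true; false; if_then_else_; _∧_; _∨_; not)
import Data.Bool as Bool
open import Data.Bool.Properties using (∨-identityʳ)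
open import Data.Empty using (⊥; ⊥-elim)
open import Data.Fin using (Fin; zero; suc)
import Data.Fin as Fin
open import Data.Fin.Properties using (_≟_; <-cmp; <-asym; any?; suc-injective)
  renaming (_<?_ to _<ᶠ?_)
open import Data.List using (List; []; _∷_; length; map; filter; allFin; upTo)
open import Data.List.Extrema.Nat using (argmin; argmax; argmin-all; argmax-all;
  f[argmin]≤f[⊤]; f[argmin]≤f[xs]; f[xs]≤f[argmax])
open import Data.List.Membership.Propositional using (_∈_; _∉_; find)
import Data.List.Membership.DecPropositional as DecMembership
open import Data.List.Membership.Propositional.Properties
  using (∈-filter⁺; ∈-filter⁻; ∈-map⁺; ∈-map⁻; ∈-allFin; ∈-upTo⁺)
open import Data.List.Relation.Unary.All as All using (All; []; _∷_)
open import Data.List.Relation.Unary.All.Properties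
  using (all-filter; map⁺; All¬⇒¬Any; ¬Any⇒All¬; ¬All⇒Any¬)
open import Data.List.Relation.Unary.Any using (here; there)
open import Data.List.Relation.Unary.AllPairs using ([]; _∷_)
open import Data.Nat using (ℕ; zero; suc; _+_; _∸_; _≤_; _<_; z≤n; s≤s; _≤?_; _<?_)
open import Data.Nat.Induction using (<-wellFounded)
open import Data.Nat.Properties using (≤-refl; ≤-trans; <-irrefl; <-trans; ≤-<-trans; <-≤-trans;
  <⇒≤; <⇒≱; ≮⇒≥; ≰⇒>; n≤0⇒n≡0; m∸n≡0⇒m≤n; m∸n≤m; n∸n≡0; m≤m+n; m≤n+m; +-mono-≤; +-identityʳ;
  module ≤-Reasoning)
open import Data.Product using (Σ; ∃; _×_; _,_; proj₁; proj₂)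
open import Data.Sum using (_⊎_; inj₁; inj₂)
open import Data.Unit using (⊤; tt)
open import Function using (_∘_)
open import Induction.WellFounded using (Acc; acc)
open import Relation.Binary using (Tri; tri<; tri≈; tri>)
open import Relation.Binary.PropositionalEquality using (_≡_; _≢_; refl; sym; trans; cong; cong₂; subst)
open import Relation.Nullary using (¬_; Dec; yes; no; does; contradiction)
open import Relation.Nullary.Decidable using (dec-true; decidable-stable; ¬?; _×-dec_; _⊎-dec_)

private
  variable
    n : ℕ
    A B : Fin n → Fin n → Set
    P : Fin n → Set
    x y z : Fin n
    xs : List (Fin n)

does-true : {P : Set} (d : Dec P) → does d ≡ true → P
does-true (yes p) _ = p

does-∧⁻ : {P Q : Set} (p : Dec P) (q : Dec Q) → does p ∧ does q ≡ true → P × Q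
does-∧⁻ (yes p) (yes q) _ = p , q

∨-true⁻ : (a b : Bool) → a ∨ b ≡ true → a ≡ true ⊎ b ≡ true
∨-true⁻ true  _ _ = inj₁ refl
∨-true⁻ false _ h = inj₂ h

0≮⇒≡0 : {m : ℕ} → ¬ 0 < m → m ≡ 0
0≮⇒≡0 ¬pos = n≤0⇒n≡0 (≮⇒≥ ¬pos)

SamePair : {A : Set} → A → A → A → A → Set
SamePair x y a b = (x ≡ a × y ≡ b) ⊎ (x ≡ b × y ≡ a)

when : {P : Set} → Dec P → ℕ → ℕ
when d m = if does d then m else 0

when-≤ : {P : Set} (d : Dec P) (m : ℕ) → when d m ≤ m
when-≤ (yes _) m = ≤-refl
when-≤ (no _)  m = z≤n

when-pos : {P : Set} (d : Dec P) {m : ℕ} → 0 < when d m → P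
when-pos (yes p) _ = p

when-no : {P : Set} (d : Dec P) {m : ℕ} → ¬ P → when d m ≡ 0
when-no (yes p) ¬p = contradiction p ¬p
when-no (no _)  _  = refl

when-yes : {P : Set} (d : Dec P) {m : ℕ} → P → when d m ≡ m
when-yes (yes _) _ = refl
when-yes (no ¬p) p = contradiction p ¬p

when-cong : {P Q : Set} (d : Dec P) (d′ : Dec Q) {m m′ : ℕ} → (P → Q) → (Q → P) → m ≡ m′ →
  when d m ≡ when d′ m′
when-cong (yes _) (yes _)  _   _   m≡m′ = m≡m′
when-cong (no _)  (no _)   _   _   _    = refl
when-cong (yes p) (no ¬q)  p→q _   _    = contradiction (p→q p) ¬q
when-cong (no ¬p) (yes q)  _   q→p _    = contradiction (q→p q) ¬p

SamePair-sym : {X : Set} {x y a b : X} → SamePair x y a b → SamePair a b x y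
SamePair-sym (inj₁ (refl , refl)) = inj₁ (refl , refl)
SamePair-sym (inj₂ (refl , refl)) = inj₂ (refl , refl)

SamePair-swap : {X : Set} {x y a b : X} → SamePair x y a b → SamePair y x a b
SamePair-swap (inj₁ (refl , refl)) = inj₂ (refl , refl)
SamePair-swap (inj₂ (refl , refl)) = inj₁ (refl , refl)

SamePair-trans : {X : Set} {x y a b c d : X} → SamePair x y a b → SamePair a b c d → SamePair x y c d
SamePair-trans (inj₁ (refl , refl)) q = q
SamePair-trans (inj₂ (refl , refl)) (inj₁ (refl , refl)) = inj₂ (refl , refl)
SamePair-trans (inj₂ (refl , refl)) (inj₂ (refl , refl)) = inj₁ (refl , refl)

sumFin-mono : {f g : Fin n → ℕ} → (∀ i → f i ≤ g i) → sumFin f ≤ sumFin g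
sumFin-mono {zero}  _   = z≤n
sumFin-mono {suc n} f≤g = +-mono-≤ (f≤g zero) (sumFin-mono (f≤g ∘ suc))

sumFin-zero : {f : Fin n → ℕ} → (∀ i → f i ≡ 0) → sumFin f ≡ 0
sumFin-zero {zero}  _   = refl
sumFin-zero {suc n} f≡0 = cong₂ _+_ (f≡0 zero) (sumFin-zero (f≡0 ∘ suc))

sumFin-single : {f : Fin n → ℕ} (x : Fin n) → (∀ i → i ≢ x → f i ≡ 0) → sumFin f ≡ f x
sumFin-single {suc n} {f} zero others =
  trans (cong (f zero +_) (sumFin-zero (λ i → others (suc i) λ ()))) (+-identityʳ (f zero))
sumFin-single {suc n} (suc x) others =
  cong₂ _+_ (others zero λ ()) (sumFin-single x λ i i≢x → others (suc i) (i≢x ∘ suc-injective))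

term≤sumFin : (f : Fin n → ℕ) (x : Fin n) → f x ≤ sumFin f
term≤sumFin f zero    = m≤m+n _ _
term≤sumFin f (suc x) = ≤-trans (term≤sumFin (f ∘ suc) x) (m≤n+m _ _)

card-mono : {S T : Fin n → Bool} → (∀ v → S v ≡ true → T v ≡ true) → card S ≤ card T
card-mono {S = S} {T} S⊆T = sumFin-mono indicator-mono
  where
  indicator-mono : ∀ v → (if S v then 1 else 0) ≤ (if T v then 1 else 0)
  indicator-mono v with S v in Sv
  ... | false = z≤n
  ... | true rewrite S⊆T v Sv = ≤-refl

pairTerm : (Fin n → Fin n → ℕ) → Fin n → Fin n → ℕ
pairTerm f u v = when (u <ᶠ? v) (f u v)

pairTerm-pos : (f : Fin n → Fin n → ℕ) {u v : Fin n} → 0 < pairTerm f u v → u Fin.< v × 0 < f u v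
pairTerm-pos f {u} {v} pos = u<v , subst (0 <_) (when-yes (u <ᶠ? v) u<v) pos
  where u<v = when-pos (u <ᶠ? v) pos

pairTerm-≤ : (f : Fin n → Fin n → ℕ) {c : ℕ} → (∀ u v → u Fin.< v → 0 < f u v → f u v ≤ c) →
  ∀ u v → pairTerm f u v ≤ c
pairTerm-≤ f bound u v with 0 <? pairTerm f u v
... | no ¬pos rewrite 0≮⇒≡0 ¬pos = z≤n
... | yes pos with pairTerm-pos f pos
...   | u<v , fpos rewrite when-yes (u <ᶠ? v) {f u v} u<v = bound u v u<v fpos

term≤sumPairs : (f : Fin n → Fin n → ℕ) {u v : Fin n} → u Fin.< v → f u v ≤ sumPairs f
term≤sumPairs f {u} {v} u<v = begin
  f u v                     ≡⟨ sym (when-yes (u <ᶠ? v) u<v) ⟩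
  pairTerm f u v            ≤⟨ term≤sumFin (pairTerm f u) v ⟩
  sumFin (pairTerm f u)     ≤⟨ term≤sumFin (λ a → sumFin (pairTerm f a)) u ⟩
  sumPairs f                ∎
  where open ≤-Reasoning

term≤sumPairs-sym : (f : Fin n → Fin n → ℕ) → (∀ u v → f u v ≡ f v u) →
  {u v : Fin n} → u ≢ v → f u v ≤ sumPairs f
term≤sumPairs-sym f f-sym {u} {v} u≢v with <-cmp u v
... | tri< u<v _ _ = term≤sumPairs f u<v
... | tri≈ _ u≡v _ = contradiction u≡v u≢v
... | tri> _ _ v<u = subst (_≤ sumPairs f) (f-sym v u) (term≤sumPairs f v<u)

sumPairs-zero : {f : Fin n → Fin n → ℕ} → (∀ u v → f u v ≡ 0) → sumPairs f ≡ 0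
sumPairs-zero {f = f} f≡0 = sumFin-zero λ u → sumFin-zero λ v →
  n≤0⇒n≡0 (subst (pairTerm f u v ≤_) (f≡0 u v) (when-≤ (u <ᶠ? v) (f u v)))

sumPairs-concentrated : (f : Fin n → Fin n → ℕ) (p q : Fin n) →
  (∀ u v → 0 < pairTerm f u v → u ≡ p × v ≡ q) → sumPairs f ≡ pairTerm f p q
sumPairs-concentrated f p q only =
  trans (sumFin-single p λ u u≢p → sumFin-zero λ v → vanish λ pos → u≢p (proj₁ (only u v pos)))
        (sumFin-single q λ v v≢q → vanish λ pos → v≢q (proj₂ (only p v pos)))
  where
  vanish : ∀ {u v} → ¬ 0 < pairTerm f u v → pairTerm f u v ≡ 0
  vanish = 0≮⇒≡0

sumPairs-≤-pair : (f : Fin n → Fin n → ℕ) (x y : Fin n) {c : ℕ} →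
  (∀ u v → u Fin.< v → 0 < f u v → f u v ≤ c × SamePair u v x y) → sumPairs f ≤ c
sumPairs-≤-pair f x y {c} h = by-order (<-cmp x y)
  where
  at : (p q : Fin _) → (∀ {u v} → SamePair u v x y → u Fin.< v → u ≡ p × v ≡ q) → sumPairs f ≤ c
  at p q orient = begin
    sumPairs f      ≡⟨ sumPairs-concentrated f p q only ⟩
    pairTerm f p q  ≤⟨ pairTerm-≤ f (λ u v u<v pos → proj₁ (h u v u<v pos)) p q ⟩
    c               ∎
    where
    open ≤-Reasoning
    only : ∀ u v → 0 < pairTerm f u v → u ≡ p × v ≡ q
    only u v pos with pairTerm-pos f pos
    ... | u<v , fpos = orient (proj₂ (h u v u<v fpos)) u<v

  by-order : Tri (x Fin.< y) (x ≡ y) (y Fin.< x) → sumPairs f ≤ c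
  by-order (tri< x<y _ _) = at x y λ where
    (inj₁ ends) _ → ends
    (inj₂ (refl , refl)) u<v → contradiction x<y (<-asym u<v)
  by-order (tri≈ _ refl _) = at x x λ where
    (inj₁ ends) _ → ends
    (inj₂ ends) _ → ends
  by-order (tri> _ _ y<x) = at y x λ where
    (inj₁ (refl , refl)) u<v → contradiction y<x (<-asym u<v)
    (inj₂ ends) _ → ends

Reachable : (Fin n → Fin n → Set) → Fin n → Fin n → Set
Reachable A x y = ∃ λ xs → IsWalk A xs x y

walk-head : IsWalk A xs x y → x ∈ xs
walk-head (single _) = here refl
walk-head (step _ _) = here refl

walk-last : IsWalk A xs x y → y ∈ xs
walk-last (single _) = here refl
walk-last (step _ w) = there (walk-last w)

walk-map : (∀ {a b} → A a b → B a b) → IsWalk A xs x y → IsWalk B xs x y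
walk-map f (single x) = single x
walk-map f (step e w) = step (f e) (walk-map f w)

walk-map-within : (∀ {a b} → P a → P b → A a b → B a b) → All P xs →
  IsWalk A xs x y → IsWalk B xs x y
walk-map-within f _                  (single x) = single x
walk-map-within f (pa ∷ ps@(pb ∷ _)) (step e w) = step (f pa pb e) (walk-map-within f ps w)

walk-within : IsWalk (λ a b → A a b × P a × P b) xs x y → P x → IsWalk A xs x y × All P xs
walk-within (single x)               px = single x , px ∷ []
walk-within (step (e , _ , pz) w) px with walk-within w pz
... | w′ , ps = step e w′ , px ∷ ps

walk-cons : A x y → IsWalk A xs y z → IsWalk A (x ∷ xs) x z
walk-cons e (single _) = step e (single _)
walk-cons e (step e′ w) = step e (step e′ w)

reach-step : A x y → Reachable A y z → Reachable A x z
reach-step e (_ , w) = _ , walk-cons e w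

reach-trans : Reachable A x y → Reachable A y z → Reachable A x z
reach-trans (_ , single _) r = r
reach-trans (_ , step e w) r = reach-step e (reach-trans (_ , w) r)

reach-sym : (∀ {a b} → A a b → A b a) → Reachable A x y → Reachable A y x
reach-sym A-sym (_ , single x) = _ , single x
reach-sym A-sym (_ , step e w) = reach-trans (reach-sym A-sym (_ , w)) (_ , step (A-sym e) (single _))

walk-crossing : ((v : Fin n) → Dec (P v)) → IsWalk A xs x y → P x → ¬ P y →
  Σ (Fin n) λ a → Σ (Fin n) λ b → A a b × P a × ¬ P b × a ∈ xs × b ∈ xs
walk-crossing P? (single _) px ¬py = contradiction px ¬py
walk-crossing P? (step {x} {z} e w) px ¬py with P? z
... | no ¬pz = x , z , e , px , ¬pz , here refl , there (walk-head w)
... | yes pz with walk-crossing P? w pz ¬py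
...   | a , b , e′ , pa , ¬pb , a∈ , b∈ = a , b , e′ , pa , ¬pb , there a∈ , there b∈

walk-or-bad-step : ((a b : Fin n) → Dec (B a b)) → IsWalk A xs x y →
  IsWalk B xs x y ⊎ (Σ (Fin n) λ a → Σ (Fin n) λ b → A a b × ¬ B a b × a ∈ xs × b ∈ xs)
walk-or-bad-step B? (single x) = inj₁ (single x)
walk-or-bad-step B? (step {x} {z} e w) with B? x z
... | no ¬b = inj₂ (x , z , e , ¬b , here refl , there (walk-head w))
... | yes b with walk-or-bad-step B? w
...   | inj₁ w′ = inj₁ (step b w′)
...   | inj₂ (a , c , e′ , ¬b′ , a∈ , c∈) = inj₂ (a , c , e′ , ¬b′ , there a∈ , there c∈)

Path : (Fin n → Fin n → Set) → Fin n → Fin n → Set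
Path A x y = ∃ λ xs → IsPath A xs x y

path-suffix : IsPath A xs x y → z ∈ xs → Path A z y
path-suffix (single x , u)   (here refl) = _ , single x , u
path-suffix (step e w , u)   (here refl) = _ , step e w , u
path-suffix (step e w , _ ∷ u) (there z∈) = path-suffix (w , u) z∈

walk⇒path : IsWalk A xs x y → Path A x y
walk⇒path (single x) = _ , single x , [] ∷ []
walk⇒path (step {x} e w) with walk⇒path w
... | ys , p , u with DecMembership._∈?_ _≟_ x ys
...   | yes x∈ys = path-suffix (p , u) x∈ys
...   | no x∉ys  = _ , walk-cons e p , ¬Any⇒All¬ ys x∉ys ∷ u

module _ {X : Set} {Q : X → Set} (Q? : (x : X) → Dec (Q x)) (f : X → ℕ) where

  argmin-filter : (xs : List X) {x₀ : X} → Q x₀ →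
    Σ X λ x → Q x × f x ≤ f x₀ × (∀ y → y ∈ xs → Q y → f x ≤ f y)
  argmin-filter xs {x₀} q₀ =
    argmin f x₀ candidates ,
    argmin-all f q₀ (all-filter Q? xs) ,
    f[argmin]≤f[⊤] {f = f} x₀ candidates ,
    λ y y∈xs qy → All.lookup (f[argmin]≤f[xs] {f = f} x₀ candidates) (∈-filter⁺ Q? y∈xs qy)
    where candidates = filter Q? xs

  argmax-filter : (xs : List X) {x₀ : X} → Q x₀ →
    Σ X λ x → Q x × (∀ y → y ∈ xs → Q y → f y ≤ f x)
  argmax-filter xs {x₀} q₀ =
    argmax f x₀ candidates ,
    argmax-all f q₀ (all-filter Q? xs) ,
    λ y y∈xs qy → All.lookup (f[xs]≤f[argmax] {f = f} x₀ candidates) (∈-filter⁺ Q? y∈xs qy)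
    where candidates = filter Q? xs

least : {Q : ℕ → Set} → ((d : ℕ) → Dec (Q d)) → {N : ℕ} → Q N →
  Σ ℕ λ d → Q d × (∀ d′ → Q d′ → d ≤ d′)
least {Q = Q} Q? {N} qN with argmin-filter Q? (λ d → d) (upTo N) qN
... | d , qd , d≤N , d≤below = d , qd , minimal
  where
  minimal : ∀ d′ → Q d′ → d ≤ d′
  minimal d′ qd′ with d′ <? N
  ... | yes d′<N = d≤below d′ (∈-upTo⁺ d′<N) qd′
  ... | no d′≮N  = ≤-trans d≤N (≮⇒≥ d′≮N)

module _ {Q : Fin n → Set} (Q? : (x : Fin n) → Dec (Q x)) (f : Fin n → ℕ) where

  argmin-Fin : {x₀ : Fin n} → Q x₀ → Σ (Fin n) λ x → Q x × (∀ y → Q y → f x ≤ f y)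
  argmin-Fin q₀ with argmin-filter Q? f (allFin _) q₀
  ... | x , qx , _ , minimal = x , qx , λ y → minimal y (∈-allFin y)

  argmax-Fin : {x₀ : Fin n} → Q x₀ → Σ (Fin n) λ x → Q x × (∀ y → Q y → f y ≤ f x)
  argmax-Fin q₀ with argmax-filter Q? f (allFin _) q₀
  ... | x , qx , maximal = x , qx , λ y → maximal y (∈-allFin y)

-- Trees given by a parent function

module ParentTree {p : ℕ} (rt : Fin p) (par : Fin p → Fin p) (depth : Fin p → ℕ)
                  (par-< : ∀ x → x ≢ rt → depth (par x) < depth x) where

  TreeAdj : Fin p → Fin p → Set
  TreeAdj a b = (a ≢ rt × par a ≡ b) ⊎ (b ≢ rt × par b ≡ a)

  TreeAdj-sym : ∀ {a b} → TreeAdj a b → TreeAdj b a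
  TreeAdj-sym (inj₁ e) = inj₂ e
  TreeAdj-sym (inj₂ e) = inj₁ e

  par-irrefl : ∀ {x} → x ≢ rt → par x ≢ x
  par-irrefl {x} x≢rt e = <-irrefl (cong depth e) (par-< x x≢rt)

  TreeAdj-irrefl : ∀ a → ¬ TreeAdj a a
  TreeAdj-irrefl a (inj₁ (a≢rt , e)) = par-irrefl a≢rt e
  TreeAdj-irrefl a (inj₂ (a≢rt , e)) = par-irrefl a≢rt e

  par-par : ∀ {x} → x ≢ rt → par x ≢ rt → par (par x) ≢ x
  par-par {x} x≢rt px≢rt e =
    <-irrefl refl (subst (λ z → depth z < depth x) e (<-trans (par-< (par x) px≢rt) (par-< x x≢rt)))

  par-ind : (Q : Fin p → Set) → Q rt → (∀ x → x ≢ rt → Q (par x) → Q x) → ∀ x → Q x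
  par-ind Q base inherit x = go x (<-wellFounded (depth x))
    where
    go : ∀ x → Acc _<_ (depth x) → Q x
    go x (acc rec) with x ≟ rt
    ... | yes refl = base
    ... | no x≢rt  = inherit x x≢rt (go (par x) (rec (par-< x x≢rt)))

  reach-root : ∀ x → Reachable TreeAdj x rt
  reach-root = par-ind (λ x → Reachable TreeAdj x rt) (_ , single rt)
    λ x x≢rt → reach-step (inj₁ (x≢rt , refl))

  TreeAdj-connected : ConnectedAdj TreeAdj
  TreeAdj-connected x y = reach-trans (reach-root x) (reach-sym TreeAdj-sym (reach-root y))

  data Ascent (Q : Fin p → Set) (t : Fin p) : Fin p → Set where
    here : Ascent Q t t
    up   : ∀ {x} → x ≢ rt → Q x → Ascent Q t (par x) → Ascent Q t x

  ascent? : {Q : Fin p → Set} → ((x : Fin p) → Dec (Q x)) → (t x : Fin p) → Dec (Ascent Q t x)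
  ascent? {Q} Q? t = par-ind (λ x → Dec (Ascent Q t x)) from-root from-parent
    where
    from-root : Dec (Ascent Q t rt)
    from-root with rt ≟ t
    ... | yes refl = yes here
    ... | no rt≢t  = no λ { here → rt≢t refl ; (up rt≢rt _ _) → rt≢rt refl }
    from-parent : ∀ x → x ≢ rt → Dec (Ascent Q t (par x)) → Dec (Ascent Q t x)
    from-parent x x≢rt d with x ≟ t | Q? x | d
    ... | yes refl | _     | _      = yes here
    ... | no x≢t   | no ¬q | _      = no λ { here → x≢t refl ; (up _ q _) → ¬q q }
    ... | no x≢t   | yes q | yes a  = yes (up x≢rt q a)
    ... | no x≢t   | yes _ | no ¬a  = no λ { here → x≢t refl ; (up _ _ a) → ¬a a }

  Anc : Fin p → Fin p → Set
  Anc = Ascent (λ _ → ⊤)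

  anc? : (s x : Fin p) → Dec (Anc s x)
  anc? = ascent? (λ _ → yes tt)

  ascent⇒anc : ∀ {Q t x} → Ascent Q t x → Anc t x
  ascent⇒anc here         = here
  ascent⇒anc (up x≢rt _ a) = up x≢rt tt (ascent⇒anc a)

  anc-root : ∀ x → Anc rt x
  anc-root = par-ind (Anc rt) here λ x x≢rt → up x≢rt tt

  root-anc : ∀ {s} → Anc s rt → s ≡ rt
  root-anc here             = refl
  root-anc (up rt≢rt _ _) = contradiction refl rt≢rt

  anc-trans : ∀ {s x y} → Anc s x → Anc x y → Anc s y
  anc-trans a here          = a
  anc-trans a (up y≢rt _ b) = up y≢rt tt (anc-trans a b)

  anc-depth : ∀ {s x} → Anc s x → depth s ≤ depth x
  anc-depth here            = ≤-refl
  anc-depth (up x≢rt _ a) = ≤-trans (anc-depth a) (<⇒≤ (par-< _ x≢rt))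

  anc-strict : ∀ {s x} → Anc s x → s ≢ x → depth s < depth x
  anc-strict here            s≢s = contradiction refl s≢s
  anc-strict (up x≢rt _ a) _   = ≤-<-trans (anc-depth a) (par-< _ x≢rt)

  anc-not-par : ∀ {s} → s ≢ rt → ¬ Anc s (par s)
  anc-not-par {s} s≢rt a = <-irrefl refl (≤-<-trans (anc-depth a) (par-< s s≢rt))

  exit-edge : ∀ {s a b} → TreeAdj a b → Anc s a → ¬ Anc s b → a ≡ s × b ≡ par s
  exit-edge (inj₁ (_ , refl)) here          _    = refl , refl
  exit-edge (inj₁ (_ , refl)) (up _ _ a)    ¬a   = contradiction a ¬a
  exit-edge (inj₂ (b≢rt , refl)) a          ¬a   = contradiction (up b≢rt tt a) ¬a

  walk-exit : ∀ {B : Fin p → Fin p → Set} {xs s x y} → (∀ {a b} → B a b → TreeAdj a b) →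
    IsWalk B xs x y → Anc s x → ¬ Anc s y → B s (par s) × s ∈ xs × par s ∈ xs
  walk-exit B⊆ w ax ¬ay with walk-crossing (anc? _) w ax ¬ay
  ... | a , b , e , aa , ¬ab , a∈ , b∈ with exit-edge (B⊆ e) aa ¬ab
  ...   | refl , refl = e , a∈ , b∈

  walk-enter : ∀ {xs s x y} → IsWalk TreeAdj xs x y → ¬ Anc s x → Anc s y → par s ∈ xs
  walk-enter (single _) ¬ax ay = contradiction ay ¬ax
  walk-enter {s = s} (step {y = z} e w) ¬ax ay with anc? s z
  ... | yes az = here (sym (proj₂ (exit-edge (TreeAdj-sym e) az ¬ax)))
  ... | no ¬az = there (walk-enter w ¬az ay)

  -- A path from x₁ that avoids x stays on x₁'s side of the edge x–x₁, so the
  -- closing edge y–x can only be that edge again.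
  cycle-closure : ∀ {x x₁ y xs} → TreeAdj x x₁ → TreeAdj y x → x ∉ xs →
    IsWalk TreeAdj xs x₁ y → y ≡ x₁
  cycle-closure {x} {x₁} {y} (inj₂ (x₁≢rt , px₁≡x)) closing x∉ w with anc? x₁ y
  ... | yes a = proj₁ (exit-edge closing a (subst (¬_ ∘ Anc x₁) px₁≡x (anc-not-par x₁≢rt)))
  ... | no ¬a =
    contradiction (subst (_∈ _) px₁≡x (proj₂ (proj₂ (walk-exit (λ e → e) w here ¬a)))) x∉
  cycle-closure (inj₁ (_ , px≡x₁)) (inj₂ (_ , px≡y)) _ _ = trans (sym px≡y) px≡x₁
  cycle-closure {x} {x₁} {y} (inj₁ (x≢rt , px≡x₁)) (inj₁ (y≢rt , py≡x)) x∉ w with anc? y x₁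
  ... | yes a =
    sym (proj₁ (exit-edge (inj₂ (x≢rt , px≡x₁)) a (subst (¬_ ∘ Anc y) py≡x (anc-not-par y≢rt))))
  ... | no ¬a = contradiction (subst (_∈ _) py≡x (walk-enter w ¬a here)) x∉

  TreeAdj-acyclic : ¬ HasCycle TreeAdj
  TreeAdj-acyclic ([] , _ , _ , () , _)
  TreeAdj-acyclic (_ ∷ [] , _ , _ , s≤s () , _)
  TreeAdj-acyclic (_ ∷ _ ∷ [] , _ , _ , s≤s (s≤s ()) , _)
  TreeAdj-acyclic (_ ∷ _ ∷ _ ∷ _ , _ , _ , _ , (step e w@(step _ w′) , x∉ ∷ x₁∉ ∷ _) , closing) =
    All¬⇒¬Any x₁∉ (subst (_∈ _) (cycle-closure e closing (All¬⇒¬Any x∉) w) (walk-last w′))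

  TreeAdj-child : ∀ {a b} → TreeAdj a b → Σ (Fin p) λ c → c ≢ rt × SamePair a b c (par c)
  TreeAdj-child (inj₁ (a≢rt , pa≡b)) = _ , a≢rt , inj₁ (refl , sym pa≡b)
  TreeAdj-child (inj₂ (b≢rt , pb≡a)) = _ , b≢rt , inj₂ (sym pb≡a , refl)

  TreeAdj-parent-pair : ∀ {a b c} → c ≢ rt → SamePair a b c (par c) → TreeAdj a b
  TreeAdj-parent-pair c≢rt (inj₁ (refl , refl)) = inj₁ (c≢rt , refl)
  TreeAdj-parent-pair c≢rt (inj₂ (refl , refl)) = inj₂ (c≢rt , refl)

  parent-pair-unique : ∀ {x y} → x ≢ rt → y ≢ rt → SamePair x (par x) y (par y) → x ≡ y
  parent-pair-unique _    _    (inj₁ (x≡y , _))      = x≡y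
  parent-pair-unique x≢rt y≢rt (inj₂ (refl , px≡y)) = contradiction px≡y (par-par y≢rt x≢rt)

  TreeAdj-tree : 1 ≤ p → IsTreeAdj TreeAdj
  TreeAdj-tree 1≤p = 1≤p , TreeAdj-connected , TreeAdj-acyclic

module Rooting {n : ℕ} {A : Fin n → Fin n → Set} (A? : ∀ u v → Dec (A u v))
               (A-sym : ∀ {u v} → A u v → A v u) (A-irrefl : ∀ v → ¬ A v v)
               (tree : IsTreeAdj A) (r : Fin n) where

  Within : ℕ → Fin n → Set
  Within zero    v = v ≡ r
  Within (suc d) v = v ≡ r ⊎ ∃ λ u → A v u × Within d u

  within? : (d : ℕ) (v : Fin n) → Dec (Within d v)
  within? zero    v = v ≟ r
  within? (suc d) v = (v ≟ r) ⊎-dec any? (λ u → A? v u ×-dec within? d u)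

  walk-within-length : ∀ {xs v} → IsWalk A xs v r → Within (length xs) v
  walk-within-length (single _) = inj₁ refl
  walk-within-length (step e w) = inj₂ (_ , e , walk-within-length w)

  opaque
    distance : (v : Fin n) → Σ ℕ λ d → Within d v × (∀ d′ → Within d′ v → d ≤ d′)
    distance v = least (λ d → within? d v) (walk-within-length (proj₂ (proj₁ (proj₂ tree) v r)))

  depth : Fin n → ℕ
  depth v = proj₁ (distance v)

  closer-neighbour : ∀ v d → Within d v → v ≢ r → Σ (Fin n) λ u → A v u × depth u < d
  closer-neighbour v zero    v≡r                v≢r = contradiction v≡r v≢r
  closer-neighbour v (suc d) (inj₁ v≡r)         v≢r = contradiction v≡r v≢r
  closer-neighbour v (suc d) (inj₂ (u , e , du)) _  = u , e , s≤s (proj₂ (proj₂ (distance u)) d du)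

  opaque
    parent : (v : Fin n) → Dec (v ≡ r) → Σ (Fin n) λ u → v ≢ r → A v u × depth u < depth v
    parent v (yes v≡r) = r , λ v≢r → contradiction v≡r v≢r
    parent v (no v≢r) with closer-neighbour v (depth v) (proj₁ (proj₂ (distance v))) v≢r
    ... | u , e , closer = u , λ _ → e , closer

  par : Fin n → Fin n
  par v = proj₁ (parent v (v ≟ r))

  par-adj : ∀ v → v ≢ r → A v (par v)
  par-adj v v≢r = proj₁ (proj₂ (parent v (v ≟ r)) v≢r)

  par-< : ∀ v → v ≢ r → depth (par v) < depth v
  par-< v v≢r = proj₂ (proj₂ (parent v (v ≟ r)) v≢r)

  open ParentTree r par depth par-< public

  TreeAdj⇒A : ∀ {u v} → TreeAdj u v → A u v
  TreeAdj⇒A (inj₁ (u≢r , refl)) = par-adj _ u≢r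
  TreeAdj⇒A (inj₂ (v≢r , refl)) = A-sym (par-adj _ v≢r)

  A⇒TreeAdj : ∀ {u v} → A u v → TreeAdj u v
  A⇒TreeAdj {u} {v} e with walk⇒path (proj₂ (TreeAdj-connected u v))
  ... | _ , single _ , _               = contradiction e (A-irrefl u)
  ... | _ , step t (single _) , _      = t
  ... | _ , p@(step _ (step _ _)) , uniq =
    contradiction (_ , u , v , s≤s (s≤s (s≤s z≤n)) , (walk-map TreeAdj⇒A p , uniq) , A-sym e)
      (proj₂ (proj₂ tree))

usesLink-head : {p : ℕ} (a c : Fin p) (ys : List (Fin p)) → usesLink a c (a ∷ c ∷ ys) ≡ true
usesLink-head a c ys rewrite dec-true (a ≟ a) refl | dec-true (c ≟ c) refl = refl

usesLink-pair : {p : ℕ} {a b x y : Fin p} → usesLink a b (x ∷ y ∷ []) ≡ true → SamePair x y a b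
usesLink-pair {a = a} {b} {x} {y} uses with ∨-true⁻ _ _ (trans (sym (∨-identityʳ _)) uses)
... | inj₁ forwards  = inj₁ (does-∧⁻ (x ≟ a) (y ≟ b) forwards)
... | inj₂ backwards = inj₂ (does-∧⁻ (x ≟ b) (y ≟ a) backwards)

first-link : {p : ℕ} {R : Fin p → Fin p → Set} {xs : List (Fin p)} {a b : Fin p} →
  IsWalk R xs a b → a ≢ b → Σ (Fin p) λ c → R a c × usesLink a c xs ≡ true
first-link (single _) a≢a = contradiction refl a≢a
first-link (step {x = a} {y = c} {ys = ys} e _) _ = c , e , usesLink-head a c ys

-- Lower bounds from a thick set

module _ {n : ℕ} (G : Multigraph n) where

  adj? : ∀ u v → Dec (Adj G u v)
  adj? u v = 0 <? mult G u v

  Adj-sym : ∀ {u v} → Adj G u v → Adj G v u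
  Adj-sym {u} {v} = subst (0 <_) (mult-sym G u v)

  Adj-irrefl : ∀ v → ¬ Adj G v v
  Adj-irrefl v = subst (¬_ ∘ (0 <_)) (sym (loopless G v)) λ ()

  AdjMinus-sym : (T : EdgeSet G) → ∀ {u v} → AdjMinus G T u v → AdjMinus G T v u
  AdjMinus-sym T {u} {v} = subst (0 <_) (cong₂ _∸_ (mult-sym G u v) (tsym T u v))

  InsideAdj : (Fin n → Bool) → Fin n → Fin n → Set
  InsideAdj S a b = Adj G a b × S a ≡ true × S b ≡ true

  induced-connected-hub : (S : Fin n → Bool) (s : Fin n) → S s ≡ true →
    (∀ x → S x ≡ true → Reachable (InsideAdj S) x s) → InducedConnected G S
  induced-connected-hub S s Ss to-hub = (s , Ss) , connect
    where
    InsideAdj-sym : ∀ {a b} → InsideAdj S a b → InsideAdj S b a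
    InsideAdj-sym (e , Sa , Sb) = Adj-sym e , Sb , Sa
    connect : ∀ x y → S x ≡ true → S y ≡ true →
      ∃ λ xs → IsWalk (Adj G) xs x y × All (λ z → S z ≡ true) xs
    connect x y Sx Sy with reach-trans (to-hub x Sx) (reach-sym InsideAdj-sym (to-hub y Sy))
    ... | xs , w = xs , walk-within w Sx

  AdjMinus⇒Adj : (T : EdgeSet G) → ∀ {u v} → AdjMinus G T u v → Adj G u v
  AdjMinus⇒Adj T {u} {v} e = ≤-trans e (m∸n≤m (mult G u v) (tm T u v))

  connected-survives : (T : EdgeSet G) {E : Fin n → Bool} {x : Fin n} →
    InducedConnected G E → E x ≡ true →
    (∀ {u v} → E u ≡ true → E v ≡ true → Adj G u v → AdjMinus G T u v) → CompContains G T x E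
  connected-survives T (_ , connected) Ex keep z Ez with connected _ z Ex Ez
  ... | xs , w , inE = xs , walk-map-within keep inE w

  cut-edge-removed : (T : EdgeSet G) → ∀ {u v} → Adj G u v → ¬ AdjMinus G T u v →
    mult G u v ≤ edgeSetSize T
  cut-edge-removed T {u} {v} e ¬e′ = begin
    mult G u v     ≤⟨ m∸n≡0⇒m≤n (0≮⇒≡0 ¬e′) ⟩
    tm T u v       ≤⟨ term≤sumPairs-sym (tm T) (tsym T) (λ { refl → Adj-irrefl u e }) ⟩
    edgeSetSize T  ∎
    where open ≤-Reasoning

  edge-loads-link-< : (D : TreeCutDecomp G) → ∀ {u v} → u Fin.< v → Adj G u v → 𝒳 D u ≢ 𝒳 D v →
    Σ (Fin (p D)) λ a → Σ (Fin (p D)) λ b → tadj D a b × mult G u v ≤ linkWeight D a b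
  edge-loads-link-< D {u} {v} u<v e split with first-link (proj₁ (routeOk D u v e)) split
  ... | c , t , uses = 𝒳 D u , c , t ,
    subst (_≤ linkWeight D (𝒳 D u) c) (cong (λ b → if b then mult G u v else 0) uses) (term≤sumPairs _ u<v)

  edge-loads-link : (D : TreeCutDecomp G) → ∀ {u v} → Adj G u v → 𝒳 D u ≢ 𝒳 D v →
    Σ (Fin (p D)) λ a → Σ (Fin (p D)) λ b → tadj D a b × mult G u v ≤ linkWeight D a b
  edge-loads-link D {u} {v} e split with <-cmp u v
  ... | tri< u<v _ _ = edge-loads-link-< D u<v e split
  ... | tri≈ _ refl _ = contradiction e (Adj-irrefl u)
  ... | tri> _ _ v<u with edge-loads-link-< D v<u (Adj-sym e) (split ∘ sym)
  ...   | a , b , t , load = a , b , t , subst (_≤ linkWeight D a b) (mult-sym G v u) load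

module ThickSet {n : ℕ} {G : Multigraph n} {k : ℕ} (thick : HasThickSet G k) where

  W : Fin n → Bool
  W = proj₁ thick

  W? : ∀ v → Dec (W v ≡ true)
  W? v = W v Bool.≟ true

  k≤|W| : k ≤ card W
  k≤|W| = proj₁ (proj₂ thick)

  W-connected : InducedConnected G W
  W-connected = proj₁ (proj₂ (proj₂ thick))

  W-thick : ∀ u v → W u ≡ true → W v ≡ true → Adj G u v → k ≤ mult G u v
  W-thick = proj₂ (proj₂ (proj₂ thick))

  W-in-one-bag : (D : TreeCutDecomp G) (t : Fin (p D)) → (∀ v → W v ≡ true → 𝒳 D v ≡ t) →
    k ≤ nodeWeight D t
  W-in-one-bag D t inside = begin
    k                             ≤⟨ k≤|W| ⟩
    card W                        ≤⟨ card-mono (λ v Wv → dec-true (𝒳 D v ≟ t) (inside v Wv)) ⟩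
    card (λ v → does (𝒳 D v ≟ t)) ≤⟨ m≤m+n _ _ ⟩
    nodeWeight D t                ∎
    where open ≤-Reasoning

  W-split-by-link : (D : TreeCutDecomp G) → ∀ {x y} → W x ≡ true → W y ≡ true → 𝒳 D x ≢ 𝒳 D y →
    Σ (Fin (p D)) λ a → Σ (Fin (p D)) λ b → tadj D a b × k ≤ linkWeight D a b
  W-split-by-link D {x} {y} Wx Wy split with proj₂ W-connected x y Wx Wy
  ... | _ , walk , inW with walk-crossing (λ z → 𝒳 D z ≟ 𝒳 D x) walk refl (split ∘ sym)
  ...   | a , b , e , a-at-x , b-not-at-x , a∈ , b∈
          with edge-loads-link G D e (λ eq → b-not-at-x (trans (sym eq) a-at-x))
  ...     | c , d , t , load = c , d , t , ≤-trans (W-thick a b (All.lookup inW a∈) (All.lookup inW b∈) e) load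

  width-≥ : (D : TreeCutDecomp G) (w : ℕ) → WidthAtMost D w → k ≤ w
  width-≥ D w (node≤ , link≤) with proj₁ W-connected
  ... | w₀ , Ww₀ with any? (λ v → W? v ×-dec ¬? (𝒳 D v ≟ 𝒳 D w₀))
  ...   | no none = ≤-trans (W-in-one-bag D (𝒳 D w₀) λ v Wv →
                      decidable-stable (𝒳 D v ≟ 𝒳 D w₀) λ split → none (v , Wv , split))
                    (node≤ (𝒳 D w₀))
  ...   | yes (v , Wv , split) with W-split-by-link D Wv Ww₀ split
  ...     | a , b , t , k≤load = ≤-trans k≤load (link≤ a b t)

  singleton : Fin n → Fin n → Bool
  singleton w v = does (v ≟ w)

  singleton-self : ∀ w → singleton w w ≡ true
  singleton-self w = dec-true (w ≟ w) refl

  singleton-connected : ∀ w → InducedConnected G (singleton w)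
  singleton-connected w = (w , singleton-self w) ,
    λ x y x∈ y∈ → walk (does-true (x ≟ w) x∈) (does-true (y ≟ w) y∈)
    where
    walk : ∀ {x y} → x ≡ w → y ≡ w →
      ∃ λ xs → IsWalk (Adj G) xs x y × All (λ z → singleton w z ≡ true) xs
    walk refl refl = _ , single w , singleton-self w ∷ []

  W-vertices : List (Fin n)
  W-vertices = filter W? (allFin n)

  W-singletons : Scramble G
  W-singletons = record
    { eggs     = map singleton W-vertices
    ; eggsConn = map⁺ (All.universal singleton-connected W-vertices)
    }

  W-singleton-egg : ∀ {E} → E ∈ eggs W-singletons → Σ (Fin n) λ w → W w ≡ true × E ≡ singleton w
  W-singleton-egg E∈ with ∈-map⁻ singleton E∈
  ... | w , w∈ , refl = w , proj₂ (∈-filter⁻ W? {xs = allFin n} w∈) , refl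

  W-singletons-hitting : HittingAtLeast W-singletons k
  W-singletons-hitting H hits = ≤-trans k≤|W| (card-mono λ v Wv →
    hit-at v (All.lookup hits (∈-map⁺ singleton (∈-filter⁺ W? (∈-allFin v) Wv))))
    where
    hit-at : ∀ v → (∃ λ x → singleton v x ≡ true × H x ≡ true) → H v ≡ true
    hit-at v (x , x∈ , Hx) = subst (λ z → H z ≡ true) (does-true (x ≟ v) x∈) Hx

  W-singletons-cut : EggCutAtLeast W-singletons k
  W-singletons-cut T (A , B , a , b , A∈ , B∈ , a-reaches-A , b-reaches-B , ¬a⇝b)
    with W-singleton-egg A∈ | W-singleton-egg B∈
  ... | w₁ , Ww₁ , refl | w₂ , Ww₂ , refl with proj₂ W-connected w₁ w₂ Ww₁ Ww₂
  ...   | _ , walk , inW with walk-or-bad-step (λ u v → 0 <? mult G u v ∸ tm T u v) walk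
  ...     | inj₁ surviving = contradiction
              (reach-trans (a-reaches-A w₁ (singleton-self w₁))
                (reach-trans (_ , surviving) (reach-sym (AdjMinus-sym G T) (b-reaches-B w₂ (singleton-self w₂)))))
              ¬a⇝b
  ...     | inj₂ (x , y , e , removed , x∈ , y∈) =
              ≤-trans (W-thick x y (All.lookup inW x∈) (All.lookup inW y∈) e) (cut-edge-removed G T e removed)

  W-singletons-order : OrderAtLeast W-singletons k
  W-singletons-order = W-singletons-hitting , W-singletons-cut

-- Heavy classes of a rooted banana tree

module BananaTree {n : ℕ} (G : Multigraph n) (banana : IsBananaTree G) (r : Fin n) (k : ℕ) where

  open Rooting (adj? G) (Adj-sym G) (Adj-irrefl G) banana r public

  Light : Fin n → Set
  Light x = mult G x (par x) ≤ k

  Heavy : Fin n → Set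
  Heavy x = k < mult G x (par x)

  -- Tops are the roots of the components of the forest of heavy bundles.
  IsTop : Fin n → Set
  IsTop t = t ≡ r ⊎ Light t

  isTop? : ∀ t → Dec (IsTop t)
  isTop? t = (t ≟ r) ⊎-dec (mult G t (par t) ≤? k)

  top-light : ∀ {t} → IsTop t → t ≢ r → Light t
  top-light (inj₁ t≡r) t≢r = contradiction t≡r t≢r
  top-light (inj₂ light) _ = light

  HeavyAscent : Fin n → Fin n → Set
  HeavyAscent = Ascent Heavy

  heavyAscent? : ∀ t x → Dec (HeavyAscent t x)
  heavyAscent? = ascent? (λ x → k <? mult G x (par x))

  heavy-within-class : ∀ {t u} → HeavyAscent t u → HeavyAscent t (par u) → u ≢ r → Heavy u
  heavy-within-class here        a u≢r = contradiction (ascent⇒anc a) (anc-not-par u≢r)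
  heavy-within-class (up _ h _) _ _   = h

  heavyClass : Fin n → Fin n → Bool
  heavyClass t v = does (heavyAscent? t v)

  heavyClass-connected : ∀ t → InducedConnected G (heavyClass t)
  heavyClass-connected t = induced-connected-hub G (heavyClass t) t (in-class here)
    λ x x∈ → climb (does-true (heavyAscent? t x) x∈)
    where
    in-class : ∀ {x} → HeavyAscent t x → heavyClass t x ≡ true
    in-class = dec-true (heavyAscent? t _)
    climb : ∀ {x} → HeavyAscent t x → Reachable (InsideAdj G (heavyClass t)) x t
    climb here              = _ , single t
    climb a@(up x≢r _ a′) = reach-step (par-adj _ x≢r , in-class a , in-class a′) (climb a′)

  heavyClass-thick : ∀ t u v → heavyClass t u ≡ true → heavyClass t v ≡ true → Adj G u v →
    suc k ≤ mult G u v
  heavyClass-thick t u v u∈ v∈ e with A⇒TreeAdj e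
  ... | inj₁ (u≢r , refl) =
          heavy-within-class (does-true (heavyAscent? t u) u∈) (does-true (heavyAscent? t v) v∈) u≢r
  ... | inj₂ (v≢r , refl) = subst (suc k ≤_) (mult-sym G v u)
          (heavy-within-class (does-true (heavyAscent? t v) v∈) (does-true (heavyAscent? t u) u∈) v≢r)

  opaque
    top-of : ∀ x → Σ (Fin n) λ t → HeavyAscent t x × IsTop t
    top-of = par-ind _ (r , here , inj₁ refl) climb
      where
      climb : ∀ x → x ≢ r → Σ (Fin n) (λ t → HeavyAscent t (par x) × IsTop t) →
        Σ (Fin n) λ t → HeavyAscent t x × IsTop t
      climb x x≢r (t , a , t-top) with isTop? x
      ... | yes x-top = x , here , x-top
      ... | no ¬x-top = t , up x≢r (≰⇒> (¬x-top ∘ inj₂)) a , t-top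

  top : Fin n → Fin n
  top x = proj₁ (top-of x)

  top-ascent : ∀ x → HeavyAscent (top x) x
  top-ascent x = proj₁ (proj₂ (top-of x))

  top-isTop : ∀ x → IsTop (top x)
  top-isTop x = proj₂ (proj₂ (top-of x))

  top-unique : ∀ {t t′ x} → HeavyAscent t x → HeavyAscent t′ x → IsTop t → IsTop t′ → t ≡ t′
  top-unique here          here          _    _     = refl
  top-unique here          (up x≢r h _) x-top _     = contradiction (top-light x-top x≢r) (<⇒≱ h)
  top-unique (up x≢r h _) here          _    x-top = contradiction (top-light x-top x≢r) (<⇒≱ h)
  top-unique (up _ _ a)    (up _ _ b)    t-top t′-top = top-unique a b t-top t′-top

  top-self : ∀ {x} → IsTop x → top x ≡ x
  top-self {x} x-top = top-unique (top-ascent x) here (top-isTop x) x-top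

  top-par : ∀ {x} → ¬ IsTop x → top x ≡ top (par x)
  top-par {x} ¬x-top = top-unique (top-ascent x)
    (up (¬x-top ∘ inj₁) (≰⇒> (¬x-top ∘ inj₂)) (top-ascent (par x))) (top-isTop x) (top-isTop (par x))

  top-depth : ∀ x → depth (top x) ≤ depth x
  top-depth x = anc-depth (ascent⇒anc (top-ascent x))

  crossing-edge : ∀ {u v} → Adj G u v → top u ≢ top v →
    Σ (Fin n) λ c → IsTop c × c ≢ r × SamePair u v c (par c)
  crossing-edge {u} {v} e split with A⇒TreeAdj e
  ... | inj₁ (u≢r , refl) = u , decidable-stable (isTop? u) (split ∘ top-par) , u≢r , inj₁ (refl , refl)
  ... | inj₂ (v≢r , refl) =
          v , decidable-stable (isTop? v) (split ∘ sym ∘ top-par) , v≢r , inj₂ (refl , refl)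

  tpar : Fin n → Fin n
  tpar x = top (par x)

  tpar-< : ∀ x → x ≢ r → depth (tpar x) < depth x
  tpar-< x x≢r = ≤-<-trans (top-depth (par x)) (par-< x x≢r)

  crossing-tops : ∀ {u v c} → IsTop c → SamePair u v c (par c) → SamePair (top u) (top v) c (tpar c)
  crossing-tops c-top (inj₁ (refl , refl)) = inj₁ (top-self c-top , refl)
  crossing-tops c-top (inj₂ (refl , refl)) = inj₂ (refl , top-self c-top)

  -- The decomposition tree links each top to the top of the heavy class above it;
  -- non-top vertices become empty leaves.
  module Contracted = ParentTree r tpar depth tpar-<

  route-of : (a b : Fin n) → Dec (a ≡ b) → List (Fin n)
  route-of a b (yes _) = a ∷ []
  route-of a b (no _)  = a ∷ b ∷ []

  contracted-route : Fin n → Fin n → List (Fin n)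
  contracted-route u v = route-of (top u) (top v) (top u ≟ top v)

  contracted-route-ok : ∀ u v → Adj G u v → IsPath Contracted.TreeAdj (contracted-route u v) (top u) (top v)
  contracted-route-ok u v e = by (top u ≟ top v)
    where
    by : (d : Dec (top u ≡ top v)) → IsPath Contracted.TreeAdj (route-of (top u) (top v) d) (top u) (top v)
    by (yes same) = subst (IsWalk _ _ _) same (single _) , [] ∷ []
    by (no split) with crossing-edge e split
    ... | c , c-top , c≢r , ends =
      step (Contracted.TreeAdj-parent-pair c≢r (crossing-tops c-top ends)) (single _) , (split ∷ []) ∷ [] ∷ []

  contracted : TreeCutDecomp G
  contracted = record
    { p       = n
    ; tadj    = Contracted.TreeAdj
    ; tadjSym = λ _ _ → Contracted.TreeAdj-sym
    ; tadjIrr = Contracted.TreeAdj-irrefl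
    ; isTree  = Contracted.TreeAdj-tree (proj₁ banana)
    ; 𝒳       = top
    ; route   = contracted-route
    ; routeOk = contracted-route-ok
    }

  route-of-uses : ∀ {a b x y} (d : Dec (x ≡ y)) → usesLink a b (route-of x y d) ≡ true →
    x ≢ y × SamePair x y a b
  route-of-uses (yes _) ()
  route-of-uses (no x≢y) uses = x≢y , usesLink-pair uses

  route-of-interior : ∀ t a b (d : Dec (a ≡ b)) →
    elemB t (route-of a b d) ∧ not (does (a ≟ t)) ∧ not (does (b ≟ t)) ≡ false
  route-of-interior t a b (yes _) with does (a ≟ t)
  ... | true  = refl
  ... | false = refl
  route-of-interior t a b (no _) with does (a ≟ t) | does (b ≟ t)
  ... | true  | _     = refl
  ... | false | true  = refl
  ... | false | false = refl

  light-pair : ∀ {c u v} → IsTop c → c ≢ r → SamePair u v c (par c) → mult G u v ≤ k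
  light-pair c-top c≢r (inj₁ (refl , refl)) = top-light c-top c≢r
  light-pair c-top c≢r (inj₂ (refl , refl)) = subst (_≤ k) (mult-sym G _ _) (top-light c-top c≢r)

  link-load : ∀ {a b c} u v → c ≢ r → SamePair a b c (tpar c) →
    0 < (if usesLink a b (contracted-route u v) then mult G u v else 0) →
    (if usesLink a b (contracted-route u v) then mult G u v else 0) ≤ k × SamePair u v c (par c)
  link-load {a} {b} {c} u v c≢r ab-at-c pos with usesLink a b (contracted-route u v) in uses
  ... | true with route-of-uses (top u ≟ top v) uses
  ...   | split , tops-at-ab with crossing-edge pos split
  ...     | c′ , c′-top , c′≢r , ends with Contracted.parent-pair-unique c′≢r c≢r
              (SamePair-trans (SamePair-sym (crossing-tops c′-top ends)) (SamePair-trans tops-at-ab ab-at-c))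
  ...       | refl = light-pair c′-top c′≢r ends , ends

  cutPair? : ∀ s u v → Dec (SamePair u v s (par s))
  cutPair? s u v = ((u ≟ s) ×-dec (v ≟ par s)) ⊎-dec ((u ≟ par s) ×-dec (v ≟ s))

  cutAt : Fin n → EdgeSet G
  cutAt s = record
    { tm   = λ u v → when (cutPair? s u v) (mult G u v)
    ; tsym = λ u v → when-cong (cutPair? s u v) (cutPair? s v u) SamePair-swap SamePair-swap (mult-sym G u v)
    ; tsub = λ u v → when-≤ (cutPair? s u v) (mult G u v)
    }

  cutAt-size : ∀ {s} → IsTop s → s ≢ r → edgeSetSize (cutAt s) ≤ k
  cutAt-size {s} s-top s≢r = sumPairs-≤-pair _ s (par s) λ u v _ pos →
    let ends = when-pos (cutPair? s u v) pos in
    ≤-trans (when-≤ (cutPair? s u v) _) (light-pair s-top s≢r ends) , ends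

  cutAt-keeps : ∀ {s u v} → Adj G u v → ¬ SamePair u v s (par s) → AdjMinus G (cutAt s) u v
  cutAt-keeps {s} {u} {v} e ¬ends = subst (λ t → 0 < mult G u v ∸ t) (sym (when-no (cutPair? s u v) ¬ends)) e

  cutAt-removes : ∀ s → ¬ AdjMinus G (cutAt s) s (par s)
  cutAt-removes s e = <-irrefl (sym (n∸n≡0 (mult G s (par s))))
    (subst (λ t → 0 < mult G s (par s) ∸ t) (when-yes (cutPair? s s (par s)) (inj₁ (refl , refl))) e)

  cutAt-inside : ∀ {s u v} → s ≢ r → Anc s u → Anc s v → Adj G u v → AdjMinus G (cutAt s) u v
  cutAt-inside {s} s≢r au av e = cutAt-keeps {s} e λ where
    (inj₁ (_ , refl)) → anc-not-par s≢r av
    (inj₂ (refl , _)) → anc-not-par s≢r au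

  cutAt-outside : ∀ {s u v} → ¬ Anc s u → ¬ Anc s v → Adj G u v → AdjMinus G (cutAt s) u v
  cutAt-outside {s} ¬au ¬av e = cutAt-keeps {s} e λ where
    (inj₁ (refl , _)) → ¬au here
    (inj₂ (_ , refl)) → ¬av here

  cutAt-separates : ∀ {s x y} → Anc s x → ¬ Anc s y → ¬ ReachMinus G (cutAt s) x y
  cutAt-separates {s} ax ¬ay (_ , w) =
    cutAt-removes s (proj₁ (walk-exit (A⇒TreeAdj ∘ AdjMinus⇒Adj G (cutAt s)) w ax ¬ay))

  connected-below-lowest : ∀ {E x} → InducedConnected G E → E x ≡ true →
    (∀ z → E z ≡ true → depth x ≤ depth z) → ∀ z → E z ≡ true → Anc x z
  connected-below-lowest {E} {x} (_ , connected) Ex lowest z Ez with anc? x z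
  ... | yes a  = a
  ... | no ¬a with connected x z Ex Ez
  ...   | _ , w , inE = contradiction
          (lowest (par x) (All.lookup inE (proj₂ (proj₂ (walk-exit A⇒TreeAdj w here ¬a)))))
          (<⇒≱ (par-< x λ x≡r → ¬a (subst (λ q → Anc q z) (sym x≡r) (anc-root z))))

  connected-through : ∀ {E t x y} → InducedConnected G E → E y ≡ true → Anc t y →
    E x ≡ true → ¬ Anc t x → E t ≡ true
  connected-through (_ , connected) Ey ay Ex ¬ax with connected _ _ Ey Ex
  ... | _ , w , inE = All.lookup inE (proj₁ (proj₂ (walk-exit A⇒TreeAdj w ay ¬ax)))

  below-class : ∀ {t t′ x} → HeavyAscent t′ x → Anc t x → ¬ HeavyAscent t x → Anc t t′ × t′ ≢ t
  below-class here           a          ¬h = a , λ { refl → ¬h here }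
  below-class (up _ _ _)     here       ¬h = contradiction here ¬h
  below-class (up x≢r h b)   (up _ _ a) ¬h = below-class b a (¬h ∘ up x≢r h)

  module ScrambleBound (𝒮 : Scramble G) (cut≥ : EggCutAtLeast 𝒮 (suc k)) where

    egg-connected : ∀ {E} → E ∈ eggs 𝒮 → InducedConnected G E
    egg-connected = All.lookup (eggsConn 𝒮)

    light-cut : ∀ {s E E′} → IsTop s → s ≢ r → E ∈ eggs 𝒮 → E′ ∈ eggs 𝒮 →
      (∀ z → E z ≡ true → Anc s z) → (∀ z → E′ z ≡ true → ¬ Anc s z) → ⊥
    light-cut {s} s-top s≢r E∈ E′∈ inside outside
      with proj₁ (egg-connected E∈) | proj₁ (egg-connected E′∈)
    ... | x , Ex | y , E′y = <⇒≱ (cut≥ (cutAt s) egg-cut) (cutAt-size s-top s≢r)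
      where
      egg-cut : IsEggCut 𝒮 (cutAt s)
      egg-cut = _ , _ , x , y , E∈ , E′∈ ,
        connected-survives G (cutAt s) (egg-connected E∈) Ex
          (λ Eu Ev → cutAt-inside s≢r (inside _ Eu) (inside _ Ev)) ,
        connected-survives G (cutAt s) (egg-connected E′∈) E′y
          (λ Eu Ev → cutAt-outside (outside _ Eu) (outside _ Ev)) ,
        cutAt-separates (inside x Ex) (outside y E′y)

    Meets : Fin n → (Fin n → Bool) → Set
    Meets t E = ∃ λ v → E v ≡ true × Anc t v

    meets? : ∀ t E → Dec (Meets t E)
    meets? t E = any? λ v → (E v Bool.≟ true) ×-dec anc? t v

    Good : Fin n → Set
    Good t = All (Meets t) (eggs 𝒮)

    root-good : Good r
    root-good = All.tabulate λ E∈ → let v , Ev = proj₁ (egg-connected E∈) in v , Ev , anc-root v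

    opaque
      deepest-good-top :
        Σ (Fin n) λ t → (IsTop t × Good t) × (∀ t′ → IsTop t′ × Good t′ → depth t′ ≤ depth t)
      deepest-good-top =
        argmax-Fin (λ t → isTop? t ×-dec All.all? (meets? t) (eggs 𝒮)) depth (inj₁ refl , root-good)

    t : Fin n
    t = proj₁ deepest-good-top

    t-good : Good t
    t-good = proj₂ (proj₁ (proj₂ deepest-good-top))

    t-deepest : ∀ t′ → IsTop t′ × Good t′ → depth t′ ≤ depth t
    t-deepest = proj₂ (proj₂ deepest-good-top)

    opaque
      lowest-of-egg : ∀ {E} → E ∈ eggs 𝒮 →
        Σ (Fin n) λ x → E x ≡ true × (∀ z → E z ≡ true → depth x ≤ depth z)
      lowest-of-egg {E} E∈ = argmin-Fin (λ v → E v Bool.≟ true) depth (proj₂ (proj₁ (egg-connected E∈)))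

    no-egg-below-class : ∀ {E x} → E ∈ eggs 𝒮 → (∀ z → E z ≡ true → Anc x z) →
      Anc t x → ¬ HeavyAscent t x → ⊥
    no-egg-below-class {E} {x} E∈ below-x t≼x ¬t⇝x with below-class (top-ascent x) t≼x ¬t⇝x
    ... | t≼t′ , t′≢t with ¬All⇒Any¬ (meets? (top x)) (eggs 𝒮) t′-bad
      where
      t′-bad : ¬ Good (top x)
      t′-bad good = <⇒≱ (anc-strict t≼t′ (t′≢t ∘ sym)) (t-deepest (top x) (top-isTop x , good))
    ... | missed with find missed
    ...   | E′ , E′∈ , ¬meets = light-cut (top-isTop x) t′≢r E∈ E′∈
            (λ z Ez → anc-trans (ascent⇒anc (top-ascent x)) (below-x z Ez))
            (λ z E′z a → ¬meets (z , E′z , a))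
      where
      t′≢r : top x ≢ r
      t′≢r t′≡r = t′≢t (trans t′≡r (sym (root-anc (subst (Anc t) t′≡r t≼t′))))

    class-meets : ∀ {E} → E ∈ eggs 𝒮 → ∃ λ v → E v ≡ true × HeavyAscent t v
    class-meets {E} E∈ with lowest-of-egg E∈ | All.lookup t-good E∈
    ... | x , Ex , lowest | y , Ey , t≼y with anc? t x | heavyAscent? t x
    ...   | no ¬t≼x | _       = t , connected-through (egg-connected E∈) Ey t≼y Ex ¬t≼x , here
    ...   | yes _   | yes t⇝x = x , Ex , t⇝x
    ...   | yes t≼x | no ¬t⇝x = ⊥-elim (no-egg-below-class E∈
              (connected-below-lowest (egg-connected E∈) Ex lowest) t≼x ¬t⇝x)

    class-hits : IsHittingSet 𝒮 (heavyClass t)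
    class-hits = All.tabulate λ E∈ → let v , Ev , t⇝v = class-meets E∈ in
      v , Ev , dec-true (heavyAscent? t v) t⇝v

  module Bounds (no-thick : ¬ HasThickSet G (suc k)) where

    card-heavyClass : ∀ t → card (heavyClass t) ≤ k
    card-heavyClass t =
      ≮⇒≥ λ big → no-thick (heavyClass t , big , heavyClass-connected t , heavyClass-thick t)

    contracted-node≤ : ∀ t → nodeWeight contracted t ≤ k
    contracted-node≤ t = begin
      nodeWeight contracted t
        ≡⟨ cong (card at-t +_) (sumPairs-zero λ u v →
             cong (λ b → if b then mult G u v else 0) (route-of-interior t (top u) (top v) (top u ≟ top v))) ⟩
      card at-t + 0         ≡⟨ +-identityʳ _ ⟩
      card at-t             ≤⟨ card-mono (λ v v-at-t → dec-true (heavyAscent? t v)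
                                 (subst (λ z → HeavyAscent z v) (does-true (top v ≟ t) v-at-t) (top-ascent v))) ⟩
      card (heavyClass t)   ≤⟨ card-heavyClass t ⟩
      k                     ∎
      where
      open ≤-Reasoning
      at-t : Fin n → Bool
      at-t v = does (top v ≟ t)

    contracted-link≤ : ∀ a b → Contracted.TreeAdj a b → linkWeight contracted a b ≤ k
    contracted-link≤ a b link with Contracted.TreeAdj-child link
    ... | c , c≢r , ab-at-c = sumPairs-≤-pair _ c (par c) λ u v _ → link-load u v c≢r ab-at-c

    contracted-width : WidthAtMost contracted k
    contracted-width = contracted-node≤ , contracted-link≤

    scramble-order< : (𝒮 : Scramble G) → ¬ OrderAtLeast 𝒮 (suc k)
    scramble-order< 𝒮 (hit≥ , cut≥) = <⇒≱ (hit≥ (heavyClass t) class-hits) (card-heavyClass t)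
      where open ScrambleBound 𝒮 cut≥

theorem3p1 : (n : ℕ) (G : Multigraph n) → IsBananaTree G → (k : ℕ) →
    IsLargestThick G k → ScrambleNumberIs G k × ScreewidthIs G k
theorem3p1 zero    G (() , _) k _
theorem3p1 (suc m) G banana k (_ , thick , largest) =
  ((W-singletons , W-singletons-order) , scramble-order<) , (contracted , contracted-width) , width-≥
  where
  open ThickSet thick
  open BananaTree G banana zero k
  open Bounds (λ thicker → <-irrefl refl (largest (suc k) thicker))
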